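{- Let $n\ge1$. In the combinatorial barcode lattice $\mathbf{BL}(2^n)$, whose elements are identified with perfect matchings of $[2n]$ (positions $p<p'$ are matched iff they carry the same label), the non-nesting matchings (those avoiding the pattern $1221$) are exactly the elements of the interval $[\,1122\cdots nn,\ 12\cdots n12\cdots n\,]$.
   Context: $\mathbf{BL}(2^n)$ is the set of words containing each of $1,\dots,n$ exactly twice in which the first occurrence of $i$ precedes the first occurrence of $i+1$ for each $i\in[n-1]$, partially ordered by the reflexive-transitive closure of: $s\lessdot t$ iff $t$ arises from $s$ by swapping two adjacent entries $a<b$ appearing as $ab$ in $s$. A word contains the pattern $1221$ if it has a subsequence of the form $abba$ with $a\ne b$ (i.e. both occurrences of some label lie strictly between the two occurrences of another label); otherwise it avoids it. -}

module Defs where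

open import Data.Nat using (ℕ; suc; _<_; _≤_; _≟_)
open import Data.List using (List; []; _∷_; _++_; map; upTo; concatMap; filter; length)
open import Data.List.Relation.Unary.All using (All)
open import Data.List.Membership.Propositional using (_∈_)
open import Data.List.Relation.Binary.Sublist.Propositional using (_⊆_)
open import Data.Product using (_×_; ∃-syntax)
open import Relation.Binary.PropositionalEquality using (_≡_; _≢_)
open import Relation.Nullary using (¬_)
open import Relation.Binary.Construct.Closure.ReflexiveTransitive using (Star)

Word : Set
Word = List ℕ

-- w ∈ BL(2^n): every entry lies in {1,…,n}, each label 1,…,n occurs exactly twice,
-- and for each i ∈ [n-1] the first occurrence of i precedes the first occurrence of i+1
-- (equivalently: any occurrence of i+1 is preceded by some occurrence of i).
record IsBL (n : ℕ) (w : Word) : Set where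
  field
    labels    : All (λ x → 1 ≤ x × x ≤ n) w
    twice     : ∀ i → 1 ≤ i → i ≤ n → length (filter (_≟ i) w) ≡ 2
    firstOrd  : ∀ i → 1 ≤ i → suc i ≤ n →
                ∀ xs ys → w ≡ xs ++ suc i ∷ ys → i ∈ xs

data Cover (n : ℕ) : Word → Word → Set where
  swap : ∀ xs ys a b → a < b →
         IsBL n (xs ++ a ∷ b ∷ ys) → IsBL n (xs ++ b ∷ a ∷ ys) →
         Cover n (xs ++ a ∷ b ∷ ys) (xs ++ b ∷ a ∷ ys)

_≤BL[_]_ : Word → ℕ → Word → Set
s ≤BL[ n ] t = Star (Cover n) s t

Contains1221 : Word → Set
Contains1221 w = ∃[ a ] ∃[ b ] (a ≢ b × (a ∷ b ∷ b ∷ a ∷ []) ⊆ w)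

Avoids1221 : Word → Set
Avoids1221 w = ¬ Contains1221 w

ups : ℕ → Word
ups n = map suc (upTo n)

bottomWord : ℕ → Word
bottomWord n = concatMap (λ i → i ∷ i ∷ []) (ups n)

topWord : ℕ → Word
topWord n = ups n ++ ups n

{-# OPTIONS --safe #-}
module Submission where

-- Containment of 1221 is inherited upwards along covers (a swap destroying an occurrence would
-- make some label occur three times), and the top word avoids 1221; hence so does every word
-- below it.
--
-- Conversely, in a 1221-avoiding w ∈ BL(2^n) the label n comes last, so w = u n v n. Erasing n
-- gives a 1221-avoiding word u v ∈ BL(2^(n-1)), which lies in the interval by induction. Appending
-- n n to a chain from the bottom word up to u v and moving the first n left across v (whose labels
-- all occur in u already, so first occurrences stay ordered) reaches w. Upwards, moving the first n
-- of w left to just behind the first n-1 yields the image of u v under "insert n after the first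
-- n-1, then append n", and this map carries the chain from u v to the top word of BL(2^(n-1))
-- onto a chain ending at the top word of BL(2^n).

open import Defs
open import Data.Nat using (ℕ; zero; suc; _+_; _≤_; _<_; z≤n; s≤s; _≟_)
open import Data.Nat.Properties
  using ( ≤-refl; ≤-trans; 1+n≰n; <-asym; <-trans; <-irrefl; <-≤-trans; ≤-antisym; ≤∧≢⇒<; <⇒≢
        ; n≤1+n; n<1+n; ≤-pred; suc-injective)
open import Data.List using ([]; _∷_; [_]; _++_; map; filter; length; upTo; concatMap)
open import Data.List.Properties
  using ( ++-assoc; ++-identityʳ; ++-monoid; ∷-injective; filter-accept; filter-reject; filter-++; length-++
        ; map-++; concatMap-++; upTo-∷ʳ)
open import Algebra.Solver.Monoid (++-monoid ℕ) using (solve; _⊕_; _⊜_)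
open import Data.List.Relation.Unary.All as All using (All; []; _∷_)
open import Data.List.Relation.Unary.All.Properties using (all-filter) renaming (filter⁺ to All-filter⁺)
open import Data.List.Relation.Unary.Any using (here; there)
open import Data.List.Membership.Propositional using (_∈_; _∉_)
open import Data.List.Membership.Propositional.Properties using (∈-++⁺ˡ; ∈-++⁺ʳ; ∈-++⁻; ∈-∃++; ∈-filter⁺)
open import Data.List.Membership.DecPropositional _≟_ using (_∈?_)
open import Data.List.Relation.Binary.Permutation.Propositional using (_↭_; refl; swap)
open import Data.List.Relation.Binary.Permutation.Propositional.Properties
  using (↭-length; filter-↭; All-resp-↭; Any-resp-↭) renaming (++⁺ˡ to ↭-++⁺ˡ)
open import Data.List.Relation.Binary.Sublist.Propositional using (_⊆_; []; _∷_; _∷ʳ_; minimum; from∈; ⊆-refl; ⊆-trans)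
open import Data.List.Relation.Binary.Sublist.Propositional.Properties using (++⁺; ++⁺ˡ; ++⁺ʳ; ∷ˡ⁻; length-mono-≤; filter⁺)
open import Data.Product using (_×_; _,_; proj₁; proj₂; ∃-syntax)
open import Data.Sum using (_⊎_; inj₁; inj₂; map₁)
open import Data.Empty using (⊥; ⊥-elim)
open import Function using (_∘_)
open import Relation.Nullary using (yes; no; Dec; ¬?)
open import Relation.Binary.PropositionalEquality
  using (_≡_; _≢_; refl; sym; trans; cong; cong₂; subst; subst₂; ≢-sym; module ≡-Reasoning)
open import Relation.Binary.Construct.Closure.ReflexiveTransitive using (Star; ε; _◅_; _◅◅_)
open import Function.Bundles using (_⇔_; mk⇔)

count : ℕ → Word → ℕ
count x w = length (filter (_≟ x) w)

count-here : ∀ x w → count x (x ∷ w) ≡ suc (count x w)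
count-here x w = cong length (filter-accept (_≟ x) refl)

count-there : ∀ {x y} w → y ≢ x → count x (y ∷ w) ≡ count x w
count-there {x} w y≢x = cong length (filter-reject (_≟ x) y≢x)

count-++ : ∀ x u v → count x (u ++ v) ≡ count x u + count x v
count-++ x u v = trans (cong length (filter-++ (_≟ x) u v)) (length-++ (filter (_≟ x) u))

count-∉ : ∀ {x} w → x ∉ w → count x w ≡ 0
count-∉ [] _ = refl
count-∉ (y ∷ w) x∉ = trans (count-there w (λ y≡x → x∉ (here (sym y≡x)))) (count-∉ w (x∉ ∘ there))

count-pos⇒∈ : ∀ {x} w → 1 ≤ count x w → x ∈ w
count-pos⇒∈ {x} (y ∷ w) pos with y ≟ x
... | yes refl = here refl
... | no y≢x = there (count-pos⇒∈ w (subst (1 ≤_) (count-there w y≢x) pos))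

∈⇒count-pos : ∀ {x w} → x ∈ w → 1 ≤ count x w
∈⇒count-pos {x} {y ∷ w} (here refl) = subst (1 ≤_) (sym (count-here x w)) (s≤s z≤n)
∈⇒count-pos {x} {y ∷ w} (there x∈w) with y ≟ x
... | yes refl = subst (1 ≤_) (sym (count-here x w)) (s≤s z≤n)
... | no y≢x = subst (1 ≤_) (sym (count-there w y≢x)) (∈⇒count-pos x∈w)

count-mono-⊆ : ∀ x {P A} → P ⊆ A → count x P ≤ count x A
count-mono-⊆ x sub = length-mono-≤ (filter⁺ (_≟ x) (_≟ x) (λ { refl px → px }) sub)

count-resp-↭ : ∀ x {u w} → u ↭ w → count x u ≡ count x w
count-resp-↭ x p = ↭-length (filter-↭ (_≟ x) p)

↭-swapAt : ∀ xs (a b : ℕ) ys → xs ++ a ∷ b ∷ ys ↭ xs ++ b ∷ a ∷ ys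
↭-swapAt xs a b ys = ↭-++⁺ˡ xs (swap a b refl)

first-occurrence : ∀ {x} w → x ∈ w → ∃[ u ] ∃[ v ] (w ≡ u ++ x ∷ v × x ∉ u)
first-occurrence {x} (y ∷ w) x∈ with y ≟ x
... | yes refl = [] , w , refl , λ ()
first-occurrence (y ∷ w) (here refl) | no y≢x = ⊥-elim (y≢x refl)
first-occurrence (y ∷ w) (there x∈) | no y≢x with first-occurrence w x∈
... | u , v , refl , x∉u = y ∷ u , v , refl , λ { (here x≡y) → y≢x (sym x≡y) ; (there x∈u) → x∉u x∈u }

count-first : ∀ {x} u v → x ∉ u → count x (u ++ x ∷ v) ≡ suc (count x v)
count-first {x} u v x∉u = trans (count-++ x u (x ∷ v)) (cong₂ _+_ (count-∉ u x∉u) (count-here x v))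

count≡0⇒∉ : ∀ {x} w → count x w ≡ 0 → x ∉ w
count≡0⇒∉ w none x∈w with () ← subst (1 ≤_) none (∈⇒count-pos x∈w)

count-suc⇒split : ∀ {x} w {k} → count x w ≡ suc k →
  ∃[ u ] ∃[ v ] (w ≡ u ++ x ∷ v × x ∉ u × count x v ≡ k)
count-suc⇒split w eq
  with u , v , refl , x∉u ← first-occurrence w (count-pos⇒∈ w (subst (1 ≤_) (sym eq) (s≤s z≤n))) =
  u , v , refl , x∉u , suc-injective (trans (sym (count-first u v x∉u)) eq)

count≡2⇒split : ∀ {x} w → count x w ≡ 2 →
  ∃[ u ] ∃[ v ] ∃[ s ] (w ≡ u ++ x ∷ v ++ x ∷ s × x ∉ u × x ∉ v × x ∉ s)
count≡2⇒split w two
  with u , r , refl , x∉u , once ← count-suc⇒split w two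
  with v , s , refl , x∉v , none ← count-suc⇒split r once =
  u , v , s , refl , x∉u , x∉v , count≡0⇒∉ s none

IsBL-label : ∀ {n w x} → IsBL n w → x ∈ w → 1 ≤ x × x ≤ n
IsBL-label bl = All.lookup (IsBL.labels bl)

smaller-label-precedes : ∀ {n w} → IsBL n w → ∀ pre c rest → w ≡ pre ++ c ∷ rest →
  ∀ {x} → 1 ≤ x → x < c → x ∈ pre
smaller-label-precedes bl pre (suc i) rest refl {x} 1≤x (s≤s x≤i) = by-cases (x ≟ i)
  where
  i∈pre : 1 ≤ i → i ∈ pre
  i∈pre 1≤i = IsBL.firstOrd bl i 1≤i (proj₂ (IsBL-label bl (∈-++⁺ʳ pre (here refl)))) pre rest refl
  by-cases : Dec (x ≡ i) → x ∈ pre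
  by-cases (yes refl) = i∈pre 1≤x
  by-cases (no x≢i) with p₁ , p₂ , refl ← ∈-∃++ (i∈pre (≤-trans 1≤x x≤i)) =
    ∈-++⁺ˡ (smaller-label-precedes bl p₁ i (p₂ ++ suc i ∷ rest) (++-assoc p₁ (i ∷ p₂) (suc i ∷ rest))
              1≤x (≤∧≢⇒< x≤i x≢i))

label-precedes-or-is : ∀ {n w} → IsBL n w → ∀ pre c rest → w ≡ pre ++ c ∷ rest →
  ∀ {x} → 1 ≤ x → x ≤ c → x ∈ pre ++ [ c ]
label-precedes-or-is bl pre c rest w≡ {x} 1≤x x≤c with x ≟ c
... | yes refl = ∈-++⁺ʳ pre (here refl)
... | no x≢c = ∈-++⁺ˡ (smaller-label-precedes bl pre c rest w≡ 1≤x (≤∧≢⇒< x≤c x≢c))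

-- Where the entry c of a split pre ++ c ∷ rest of xs ++ x ∷ y ∷ ys lies relative to the pair x y.
data Locate (x y : ℕ) : Word → Word → Word → ℕ → Word → Set where
  inPrefix : ∀ pre c q ys → Locate x y (pre ++ c ∷ q) ys pre c (q ++ x ∷ y ∷ ys)
  atFirst  : ∀ xs ys → Locate x y xs ys xs x (y ∷ ys)
  atSecond : ∀ xs ys → Locate x y xs ys (xs ++ [ x ]) y ys
  inSuffix : ∀ xs p c rest → Locate x y xs (p ++ c ∷ rest) (xs ++ x ∷ y ∷ p) c rest

locate : ∀ xs x y ys pre c rest → xs ++ x ∷ y ∷ ys ≡ pre ++ c ∷ rest → Locate x y xs ys pre c rest
locate [] x y ys [] c rest refl = atFirst [] ys
locate [] x y ys (_ ∷ []) c rest refl = atSecond [] ys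
locate [] x y ys (_ ∷ _ ∷ p) c rest refl = inSuffix [] p c rest
locate (z ∷ xs) x y ys [] c rest refl = inPrefix [] z xs ys
locate (z ∷ xs) x y ys (_ ∷ pre) c rest eq with refl , eq′ ← ∷-injective eq with locate xs x y ys pre c rest eq′
... | inPrefix pre c q ys = inPrefix (z ∷ pre) c q ys
... | atFirst xs ys = atFirst (z ∷ xs) ys
... | atSecond xs ys = atSecond (z ∷ xs) ys
... | inSuffix xs p c rest = inSuffix (z ∷ xs) p c rest

FirstOrdered : ℕ → Word → Set
FirstOrdered n w = ∀ i → 1 ≤ i → suc i ≤ n → ∀ xs ys → w ≡ xs ++ suc i ∷ ys → i ∈ xs

FirstOrdered-swap : ∀ {n} xs x y ys → x ∈ xs ⊎ suc x ≢ y →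
  FirstOrdered n (xs ++ x ∷ y ∷ ys) → FirstOrdered n (xs ++ y ∷ x ∷ ys)
FirstOrdered-swap xs x y ys safe ord i 1≤i i<n pre rest eq with locate xs y x ys pre (suc i) rest eq
... | inPrefix pre _ q ys = ord i 1≤i i<n pre (q ++ x ∷ y ∷ ys) (++-assoc pre (suc i ∷ q) (x ∷ y ∷ ys))
... | atFirst xs ys with ∈-++⁻ xs (ord i 1≤i i<n (xs ++ [ x ]) ys (sym (++-assoc xs [ x ] (suc i ∷ ys))))
...   | inj₁ i∈xs = i∈xs
...   | inj₂ (here refl) with safe
...     | inj₁ i∈xs = i∈xs
...     | inj₂ 1+i≢1+i = ⊥-elim (1+i≢1+i refl)
FirstOrdered-swap xs x y ys safe ord i 1≤i i<n pre rest eq | atSecond xs ys =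
  ∈-++⁺ˡ (ord i 1≤i i<n xs (y ∷ ys) refl)
FirstOrdered-swap xs x y ys safe ord i 1≤i i<n pre rest eq | inSuffix xs p _ rest =
  Any-resp-↭ (↭-swapAt xs x y p)
    (ord i 1≤i i<n (xs ++ x ∷ y ∷ p) rest (sym (++-assoc xs (x ∷ y ∷ p) (suc i ∷ rest))))

IsBL-swap : ∀ {n} xs x y ys → x ∈ xs ⊎ suc x ≢ y → IsBL n (xs ++ x ∷ y ∷ ys) → IsBL n (xs ++ y ∷ x ∷ ys)
IsBL-swap xs x y ys safe bl = record
  { labels = All-resp-↭ (↭-swapAt xs x y ys) (IsBL.labels bl)
  ; twice = λ i 1≤i i≤n → trans (sym (count-resp-↭ i (↭-swapAt xs x y ys))) (IsBL.twice bl i 1≤i i≤n)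
  ; firstOrd = FirstOrdered-swap xs x y ys safe (IsBL.firstOrd bl)
  }

-- Chains of ascent swaps

-- An ascent swap that never moves an a + 1 in front of all occurrences of a. Unlike
-- `Cover` it carries no membership proofs: `IsBL-swap` supplies them along a chain.
data _↝_ : Word → Word → Set where
  ascent : ∀ xs a b ys → a < b → a ∈ xs ⊎ suc a ≢ b → (xs ++ a ∷ b ∷ ys) ↝ (xs ++ b ∷ a ∷ ys)

infix 4 _↝_ _↝*_

_↝*_ : Word → Word → Set
_↝*_ = Star _↝_

↝*⇒≤BLˡ : ∀ {n s t} → IsBL n s → s ↝* t → s ≤BL[ n ] t
↝*⇒≤BLˡ bl ε = ε
↝*⇒≤BLˡ bl (ascent xs a b ys a<b safe ◅ steps) = swap xs ys a b a<b bl bl′ ◅ ↝*⇒≤BLˡ bl′ steps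
  where bl′ = IsBL-swap xs a b ys safe bl

≤BL-IsBLˡ : ∀ {n s t} → IsBL n t → s ≤BL[ n ] t → IsBL n s
≤BL-IsBLˡ bl ε = bl
≤BL-IsBLˡ _ (swap _ _ _ _ _ bl _ ◅ _) = bl

↝*⇒≤BLʳ : ∀ {n s t} → IsBL n t → s ↝* t → s ≤BL[ n ] t
↝*⇒≤BLʳ bl ε = ε
↝*⇒≤BLʳ bl (ascent xs a b ys a<b _ ◅ steps) = swap xs ys a b a<b bl′ (≤BL-IsBLˡ bl rest) ◅ rest
  where
  rest = ↝*⇒≤BLʳ bl steps
  bl′ = IsBL-swap xs b a ys (inj₂ (≢-sym (<⇒≢ (<-trans a<b (n<1+n b))))) (≤BL-IsBLˡ bl rest)

↝-resp-≡ : ∀ {s t} xs a b ys → a < b → a ∈ xs ⊎ suc a ≢ b →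
  s ≡ xs ++ a ∷ b ∷ ys → t ≡ xs ++ b ∷ a ∷ ys → s ↝ t
↝-resp-≡ xs a b ys a<b safe refl refl = ascent xs a b ys a<b safe

↝*-++ʳ : ∀ z {s t} → s ↝* t → (s ++ z) ↝* (t ++ z)
↝*-++ʳ z ε = ε
↝*-++ʳ z (ascent xs a b ys a<b safe ◅ steps) =
  ↝-resp-≡ xs a b (ys ++ z) a<b safe (++-assoc xs (a ∷ b ∷ ys) z) (++-assoc xs (b ∷ a ∷ ys) z)
  ◅ ↝*-++ʳ z steps

↝*-moveLeft : ∀ pre v m post → All (λ x → x < m × x ∈ pre) v →
  (pre ++ v ++ m ∷ post) ↝* (pre ++ m ∷ v ++ post)
↝*-moveLeft pre [] m post [] = ε
↝*-moveLeft pre (x ∷ v) m post ((x<m , x∈pre) ∷ rest) =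
  subst₂ _↝*_ (++-assoc pre [ x ] (v ++ m ∷ post)) (++-assoc pre [ x ] (m ∷ v ++ post))
    (↝*-moveLeft (pre ++ [ x ]) v m post (All.map (λ (y<m , y∈pre) → y<m , ∈-++⁺ˡ y∈pre) rest))
  ◅◅ ascent pre x m (v ++ post) x<m (inj₁ x∈pre) ◅ ε

All-↝ : ∀ {P : ℕ → Set} {s t} → s ↝ t → All P s → All P t
All-↝ (ascent xs a b ys _ _) = All-resp-↭ (↭-swapAt xs a b ys)

-- Inserting a label after the first occurrence of another

insertAfterFirst : ℕ → ℕ → Word → Word
insertAfterFirst L m [] = []
insertAfterFirst L m (x ∷ xs) with x ≟ L
... | yes _ = x ∷ m ∷ xs
... | no _ = x ∷ insertAfterFirst L m xs

insertAfterFirst-here : ∀ L m xs → insertAfterFirst L m (L ∷ xs) ≡ L ∷ m ∷ xs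
insertAfterFirst-here L m xs with L ≟ L
... | yes _ = refl
... | no L≢L = ⊥-elim (L≢L refl)

insertAfterFirst-there : ∀ {L m x} xs → x ≢ L → insertAfterFirst L m (x ∷ xs) ≡ x ∷ insertAfterFirst L m xs
insertAfterFirst-there {L} {m} {x} xs x≢L with x ≟ L
... | yes x≡L = ⊥-elim (x≢L x≡L)
... | no _ = refl

insertAfterFirst-++ˡ : ∀ {L m} xs zs → L ∈ xs → insertAfterFirst L m (xs ++ zs) ≡ insertAfterFirst L m xs ++ zs
insertAfterFirst-++ˡ {L} (x ∷ xs) zs L∈ with x ≟ L
... | yes _ = refl
insertAfterFirst-++ˡ (x ∷ xs) zs (here L≡x) | no x≢L = ⊥-elim (x≢L (sym L≡x))
insertAfterFirst-++ˡ (x ∷ xs) zs (there L∈xs) | no _ = cong (x ∷_) (insertAfterFirst-++ˡ xs zs L∈xs)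

insertAfterFirst-++ʳ : ∀ {L m} xs zs → L ∉ xs → insertAfterFirst L m (xs ++ zs) ≡ xs ++ insertAfterFirst L m zs
insertAfterFirst-++ʳ [] zs _ = refl
insertAfterFirst-++ʳ (x ∷ xs) zs L∉ =
  trans (insertAfterFirst-there (xs ++ zs) (λ x≡L → L∉ (here (sym x≡L))))
        (cong (x ∷_) (insertAfterFirst-++ʳ xs zs (L∉ ∘ there)))

insertAfterFirst-first : ∀ {L m} u r → L ∉ u → insertAfterFirst L m (u ++ L ∷ r) ≡ u ++ L ∷ m ∷ r
insertAfterFirst-first {L} {m} u r L∉u =
  trans (insertAfterFirst-++ʳ u (L ∷ r) L∉u) (cong (u ++_) (insertAfterFirst-here L m r))

∈-insertAfterFirst : ∀ {L m a} xs → a ∈ xs → a ∈ insertAfterFirst L m xs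
∈-insertAfterFirst {L} (x ∷ xs) a∈ with x ≟ L | a∈
... | yes _ | here a≡x = here a≡x
... | yes _ | there a∈xs = there (there a∈xs)
... | no _ | here a≡x = here a≡x
... | no _ | there a∈xs = there (∈-insertAfterFirst xs a∈xs)

↝-insertAfterFirst : ∀ {L m s t} → L < m → All (_≤ L) s → s ↝ t →
  insertAfterFirst L m s ↝* insertAfterFirst L m t
↝-insertAfterFirst {L} {m} L<m s≤L (ascent xs a b ys a<b safe) with L ∈? xs
... | yes L∈xs rewrite insertAfterFirst-++ˡ {L} {m} xs (a ∷ b ∷ ys) L∈xs
                     | insertAfterFirst-++ˡ {L} {m} xs (b ∷ a ∷ ys) L∈xs =
  ascent (insertAfterFirst L m xs) a b ys a<b (map₁ (∈-insertAfterFirst xs) safe) ◅ ε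
... | no L∉xs rewrite insertAfterFirst-++ʳ {L} {m} xs (a ∷ b ∷ ys) L∉xs
                    | insertAfterFirst-++ʳ {L} {m} xs (b ∷ a ∷ ys) L∉xs =
  by-cases (b ≟ L)
  where
  a≢L : a ≢ L
  a≢L = <⇒≢ (<-≤-trans a<b (All.lookup s≤L (∈-++⁺ʳ xs (there (here refl)))))
  -- If b is the first L, the inserted m moves along with it and a must pass m as well.
  by-cases : Dec (b ≡ L) → (xs ++ insertAfterFirst L m (a ∷ b ∷ ys)) ↝* (xs ++ insertAfterFirst L m (b ∷ a ∷ ys))
  by-cases (yes refl) rewrite insertAfterFirst-there {m = m} (b ∷ ys) a≢L
                            | insertAfterFirst-here b m ys | insertAfterFirst-here b m (a ∷ ys) =
    ascent xs a b (m ∷ ys) a<b safe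
    ◅ ↝-resp-≡ (xs ++ [ b ]) a m ys (<-trans a<b L<m) (inj₂ (<⇒≢ (<-≤-trans (s≤s a<b) L<m)))
        (sym (++-assoc xs [ b ] (a ∷ m ∷ ys))) (sym (++-assoc xs [ b ] (m ∷ a ∷ ys)))
    ◅ ε
  by-cases (no b≢L) rewrite insertAfterFirst-there {m = m} (b ∷ ys) a≢L | insertAfterFirst-there {m = m} ys b≢L
                          | insertAfterFirst-there {m = m} (a ∷ ys) b≢L | insertAfterFirst-there {m = m} ys a≢L =
    ascent xs a b (insertAfterFirst L m ys) a<b safe ◅ ε

↝*-insertAfterFirst : ∀ {L m s t} → L < m → All (_≤ L) s → s ↝* t →
  insertAfterFirst L m s ↝* insertAfterFirst L m t
↝*-insertAfterFirst L<m s≤L ε = ε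
↝*-insertAfterFirst L<m s≤L (step ◅ steps) =
  ↝-insertAfterFirst L<m s≤L step ◅◅ ↝*-insertAfterFirst L<m (All-↝ step s≤L) steps

-- Erasing the largest label

erase : ℕ → Word → Word
erase m = filter (λ x → ¬? (x ≟ m))

erase-here : ∀ m w → erase m (m ∷ w) ≡ erase m w
erase-here m w = filter-reject (λ x → ¬? (x ≟ m)) (λ m≢m → m≢m refl)

erase-there : ∀ {m x} w → x ≢ m → erase m (x ∷ w) ≡ x ∷ erase m w
erase-there {m} w x≢m = filter-accept (λ x → ¬? (x ≟ m)) x≢m

erase-∉ : ∀ {m} w → m ∉ w → erase m w ≡ w
erase-∉ [] _ = refl
erase-∉ (x ∷ w) m∉ = trans (erase-there w (λ x≡m → m∉ (here (sym x≡m)))) (cong (x ∷_) (erase-∉ w (m∉ ∘ there)))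

erase-twice : ∀ m u v → m ∉ u → m ∉ v → erase m (u ++ m ∷ v ++ [ m ]) ≡ u ++ v
erase-twice m u v m∉u m∉v = begin
  erase m (u ++ m ∷ v ++ [ m ])         ≡⟨ filter-++ _ u (m ∷ v ++ [ m ]) ⟩
  erase m u ++ erase m (m ∷ v ++ [ m ]) ≡⟨ cong₂ _++_ (erase-∉ u m∉u) (erase-here m (v ++ [ m ])) ⟩
  u ++ erase m (v ++ [ m ])             ≡⟨ cong (u ++_) (filter-++ _ v [ m ]) ⟩
  u ++ erase m v ++ erase m [ m ]       ≡⟨ cong (λ z → u ++ z ++ erase m [ m ]) (erase-∉ v m∉v) ⟩
  u ++ v ++ erase m [ m ]               ≡⟨ cong (λ z → u ++ v ++ z) (erase-here m []) ⟩
  u ++ v ++ []                          ≡⟨ cong (u ++_) (++-identityʳ v) ⟩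
  u ++ v                                ∎
  where open ≡-Reasoning

erase-split : ∀ {m} w xs c ys → erase m w ≡ xs ++ c ∷ ys →
  ∃[ pre ] ∃[ rest ] (w ≡ pre ++ c ∷ rest × xs ≡ erase m pre)
erase-split [] [] c ys ()
erase-split [] (_ ∷ _) c ys ()
erase-split {m} (y ∷ w) xs c ys eq with y ≟ m
... | yes refl with pre , rest , refl , refl ← erase-split w xs c ys (trans (sym (erase-here m w)) eq) =
  y ∷ pre , rest , refl , sym (erase-here m pre)
erase-split (y ∷ w) [] c ys eq | no y≢m with refl , _ ← ∷-injective (trans (sym (erase-there w y≢m)) eq) =
  [] , w , refl , refl
erase-split (y ∷ w) (x ∷ xs) c ys eq | no y≢m
  with refl , eq′ ← ∷-injective (trans (sym (erase-there w y≢m)) eq)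
  with pre , rest , refl , refl ← erase-split w xs c ys eq′ =
  y ∷ pre , rest , refl , sym (erase-there pre y≢m)

count-erase : ∀ {i m} w → i ≢ m → count i (erase m w) ≡ count i w
count-erase [] _ = refl
count-erase {i} {m} (y ∷ w) i≢m with y ≟ m
... | yes refl = begin
  count i (erase y (y ∷ w))           ≡⟨ cong (count i) (erase-here y w) ⟩
  count i (erase y w)                 ≡⟨ count-erase w i≢m ⟩
  count i w                           ≡⟨ count-there w (≢-sym i≢m) ⟨
  count i (y ∷ w)                     ∎
  where open ≡-Reasoning
... | no y≢m = begin
  count i (erase m (y ∷ w))           ≡⟨ cong (count i) (erase-there w y≢m) ⟩
  count i ([ y ] ++ erase m w)        ≡⟨ count-++ i [ y ] (erase m w) ⟩
  count i [ y ] + count i (erase m w) ≡⟨ cong (count i [ y ] +_) (count-erase w i≢m) ⟩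
  count i [ y ] + count i w           ≡⟨ count-++ i [ y ] w ⟨
  count i (y ∷ w)                     ∎
  where open ≡-Reasoning

IsBL-erase-max : ∀ {k w} → IsBL (suc k) w → IsBL k (erase (suc k) w)
IsBL-erase-max {k} {w} bl = record
  { labels = All.map (λ ((1≤x , x≤m) , x≢m) → 1≤x , ≤-pred (≤∧≢⇒< x≤m x≢m))
               (All.zip (All-filter⁺ _ (IsBL.labels bl) , all-filter _ w))
  ; twice = λ i 1≤i i≤k → trans (count-erase w (<⇒≢ (s≤s i≤k))) (IsBL.twice bl i 1≤i (≤-trans i≤k (n≤1+n k)))
  ; firstOrd = firstOrd
  }
  where
  firstOrd : FirstOrdered k (erase (suc k) w)
  firstOrd i 1≤i i<k xs ys eq with pre , rest , w≡ , refl ← erase-split w xs (suc i) ys eq =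
    ∈-filter⁺ _ (IsBL.firstOrd bl i 1≤i (≤-trans i<k (n≤1+n k)) pre rest w≡) (<⇒≢ (≤-trans i<k (n≤1+n k)))

∷⊆⇒∈ : ∀ {x : ℕ} {P A} → x ∷ P ⊆ A → x ∈ A
∷⊆⇒∈ (_ ∷ʳ sub) = there (∷⊆⇒∈ sub)
∷⊆⇒∈ (refl ∷ _) = here refl

∷∷⊆⇒pair⊆ : ∀ {x y : ℕ} {P A} → x ∷ y ∷ P ⊆ A → x ∷ y ∷ [] ⊆ A
∷∷⊆⇒pair⊆ {P = P} sub = ⊆-trans (refl ∷ refl ∷ minimum P) sub

pair⊆⇒split : ∀ {x y : ℕ} {A} → x ∷ y ∷ [] ⊆ A → ∃[ q₁ ] ∃[ q₂ ] (A ≡ q₁ ++ x ∷ q₂ × y ∈ q₂)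
pair⊆⇒split (z ∷ʳ sub) with q₁ , q₂ , refl , y∈q₂ ← pair⊆⇒split sub = z ∷ q₁ , q₂ , refl , y∈q₂
pair⊆⇒split {A = _ ∷ A} (refl ∷ sub) = [] , A , refl , ∷⊆⇒∈ sub

⊆-++-split : ∀ (A B : Word) {P} → P ⊆ A ++ B → ∃[ P₁ ] ∃[ P₂ ] (P ≡ P₁ ++ P₂ × P₁ ⊆ A × P₂ ⊆ B)
⊆-++-split [] B sub = [] , _ , refl , [] , sub
⊆-++-split (x ∷ A) B (_ ∷ʳ sub) with P₁ , P₂ , refl , sub₁ , sub₂ ← ⊆-++-split A B sub =
  P₁ , P₂ , refl , x ∷ʳ sub₁ , sub₂
⊆-++-split (x ∷ A) B (refl ∷ sub) with P₁ , P₂ , refl , sub₁ , sub₂ ← ⊆-++-split A B sub =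
  x ∷ P₁ , P₂ , refl , refl ∷ sub₁ , sub₂

⊆-swapAt : ∀ xs (a b : ℕ) ys {P} → P ⊆ xs ++ a ∷ b ∷ ys →
  P ⊆ xs ++ b ∷ a ∷ ys ⊎ ∃[ P₁ ] ∃[ P₂ ] (P ≡ P₁ ++ a ∷ b ∷ P₂ × P₁ ⊆ xs × P₂ ⊆ ys)
⊆-swapAt [] a b ys (_ ∷ʳ (_ ∷ʳ sub)) = inj₁ (b ∷ʳ (a ∷ʳ sub))
⊆-swapAt [] a b ys (_ ∷ʳ (refl ∷ sub)) = inj₁ (refl ∷ (a ∷ʳ sub))
⊆-swapAt [] a b ys (refl ∷ (_ ∷ʳ sub)) = inj₁ (b ∷ʳ (refl ∷ sub))
⊆-swapAt [] a b ys (refl ∷ (refl ∷ sub)) = inj₂ ([] , _ , refl , [] , sub)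
⊆-swapAt (x ∷ xs) a b ys (_ ∷ʳ sub) with ⊆-swapAt xs a b ys sub
... | inj₁ sub′ = inj₁ (x ∷ʳ sub′)
... | inj₂ (P₁ , P₂ , refl , sub₁ , sub₂) = inj₂ (P₁ , P₂ , refl , x ∷ʳ sub₁ , sub₂)
⊆-swapAt (x ∷ xs) a b ys (refl ∷ sub) with ⊆-swapAt xs a b ys sub
... | inj₁ sub′ = inj₁ (refl ∷ sub′)
... | inj₂ (P₁ , P₂ , refl , sub₁ , sub₂) = inj₂ (x ∷ P₁ , P₂ , refl , refl ∷ sub₁ , sub₂)

IsBL-no-triple : ∀ {n w y} → IsBL n w → y ∷ y ∷ y ∷ [] ⊆ w → ⊥
IsBL-no-triple {y = y} bl sub with 1≤y , y≤n ← IsBL-label bl (∷⊆⇒∈ sub) =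
  1+n≰n (subst₂ _≤_ count-triple (IsBL.twice bl y 1≤y y≤n) (count-mono-⊆ y sub))
  where
  count-triple : count y (y ∷ y ∷ y ∷ []) ≡ 3
  count-triple = trans (count-here y _) (cong suc (trans (count-here y _) (cong suc (count-here y []))))

-- An occurrence x y y x destroyed by swapping the ascent a b has (a , b) = (x , y) or (y , x);
-- either way the smaller label a also occurs further left, hence three times.
Cover-Contains1221 : ∀ {n s t} → Cover n s t → Contains1221 s → Contains1221 t
Cover-Contains1221 (swap xs ys a b a<b bls blt) (x , y , x≢y , sub) with ⊆-swapAt xs a b ys sub
... | inj₁ sub′ = x , y , x≢y , sub′
... | inj₂ ([] , _ , refl , _ , sub₂) = ⊥-elim (IsBL-no-triple bls x-thrice)
  where
  x∈xs = smaller-label-precedes blt xs y (x ∷ ys) refl (proj₁ (IsBL-label bls (∈-++⁺ʳ xs (here refl)))) a<b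
  x-thrice = ++⁺ (from∈ x∈xs) (refl ∷ (y ∷ʳ from∈ (∷⊆⇒∈ (∷ˡ⁻ sub₂))))
... | inj₂ (_ ∷ [] , _ , refl , _ , _) = ⊥-elim (<-irrefl refl a<b)
... | inj₂ (_ ∷ _ ∷ [] , [] , refl , sub₁ , _) with q₁ , q₂ , refl , y∈q₂ ← pair⊆⇒split sub₁ =
  ⊥-elim (IsBL-no-triple bls (subst (y ∷ y ∷ y ∷ [] ⊆_) (sym w≡) y-thrice))
  where
  w≡ : (q₁ ++ x ∷ q₂) ++ y ∷ x ∷ ys ≡ q₁ ++ x ∷ q₂ ++ y ∷ x ∷ ys
  w≡ = ++-assoc q₁ (x ∷ q₂) (y ∷ x ∷ ys)
  y∈q₁ = smaller-label-precedes bls q₁ x (q₂ ++ y ∷ x ∷ ys) w≡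
           (proj₁ (IsBL-label bls (∈-++⁺ʳ (q₁ ++ x ∷ q₂) (here refl)))) a<b
  y-thrice = ++⁺ (from∈ y∈q₁) (x ∷ʳ ++⁺ (from∈ y∈q₂) (refl ∷ minimum _))
... | inj₂ (_ ∷ _ ∷ [] , _ ∷ _ , () , _ , _)
... | inj₂ (_ ∷ _ ∷ _ ∷ [] , _ , () , _ , _)
... | inj₂ (_ ∷ _ ∷ _ ∷ _ ∷ [] , _ , () , _ , _)
... | inj₂ (_ ∷ _ ∷ _ ∷ _ ∷ _ ∷ _ , _ , () , _ , _)

≤BL-Contains1221 : ∀ {n s t} → s ≤BL[ n ] t → Contains1221 s → Contains1221 t
≤BL-Contains1221 ε c = c
≤BL-Contains1221 (cover ◅ covers) c = ≤BL-Contains1221 covers (Cover-Contains1221 cover c)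

ups-suc : ∀ k → ups (suc k) ≡ ups k ++ [ suc k ]
ups-suc k = trans (cong (map suc) (sym (upTo-∷ʳ k))) (map-++ suc (upTo k) [ k ])

bottomWord-suc : ∀ k → bottomWord (suc k) ≡ bottomWord k ++ suc k ∷ suc k ∷ []
bottomWord-suc k = trans (cong (concatMap (λ i → i ∷ i ∷ [])) (ups-suc k)) (concatMap-++ _ (ups k) [ suc k ])

∈-ups⇒≤ : ∀ k {x} → x ∈ ups k → x ≤ k
∈-ups⇒≤ (suc k) {x} x∈ with ∈-++⁻ (ups k) (subst (x ∈_) (ups-suc k) x∈)
... | inj₁ x∈ups = ≤-trans (∈-ups⇒≤ k x∈ups) (n≤1+n k)
... | inj₂ (here refl) = ≤-refl

ups-increasing : ∀ k {a b} → a ∷ b ∷ [] ⊆ ups k → a < b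
ups-increasing (suc k) {a} {b} sub with ⊆-++-split (ups k) [ suc k ] (subst (a ∷ b ∷ [] ⊆_) (ups-suc k) sub)
... | [] , _ , refl , _ , (_ ∷ʳ ())
... | [] , _ , refl , _ , (refl ∷ ())
... | _ ∷ [] , _ , refl , sub₁ , sub₂ with here refl ← ∷⊆⇒∈ sub₂ = s≤s (∈-ups⇒≤ k (∷⊆⇒∈ sub₁))
ups-increasing (suc k) sub | _ ∷ _ ∷ [] , _ , refl , sub₁ , _ = ups-increasing k sub₁

topWord-avoids : ∀ n → Avoids1221 (topWord n)
topWord-avoids n (x , y , _ , sub) with ⊆-++-split (ups n) (ups n) sub
... | [] , _ , refl , _ , sub₂ = <-irrefl refl (ups-increasing n (∷∷⊆⇒pair⊆ (∷ˡ⁻ sub₂)))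
... | _ ∷ [] , _ , refl , _ , sub₂ = <-irrefl refl (ups-increasing n (∷∷⊆⇒pair⊆ sub₂))
... | _ ∷ _ ∷ [] , _ , refl , sub₁ , sub₂ = <-asym (ups-increasing n sub₁) (ups-increasing n sub₂)
... | _ ∷ _ ∷ _ ∷ [] , _ , refl , sub₁ , _ = <-irrefl refl (ups-increasing n (∷ˡ⁻ sub₁))
... | _ ∷ _ ∷ _ ∷ _ ∷ [] , _ , refl , sub₁ , _ = <-irrefl refl (ups-increasing n (∷∷⊆⇒pair⊆ (∷ˡ⁻ sub₁)))
... | _ ∷ _ ∷ _ ∷ _ ∷ _ ∷ _ , _ , () , _ , _

-- 1221-avoiding words

-- If some z followed the second occurrence of the largest label m, then z < m would also occur
-- in front of the first m, giving z m m z.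
Avoids1221-max-split : ∀ {k w} → IsBL (suc k) w → Avoids1221 w →
  ∃[ u ] ∃[ v ] (w ≡ u ++ suc k ∷ v ++ [ suc k ] × suc k ∉ u × suc k ∉ v)
Avoids1221-max-split {k} {w} bl av with count≡2⇒split w (IsBL.twice bl (suc k) (s≤s z≤n) ≤-refl)
... | u , v , [] , refl , m∉u , m∉v , _ = u , v , refl , m∉u , m∉v
... | u , v , z ∷ s , refl , m∉u , m∉v , m∉zs = ⊥-elim (av (z , suc k , z≢m , z-m-m-z))
  where
  z≢m : z ≢ suc k
  z≢m z≡m = m∉zs (here (sym z≡m))
  z-label = IsBL-label bl (∈-++⁺ʳ u (there (∈-++⁺ʳ v (there (here refl)))))
  z∈u = smaller-label-precedes bl u (suc k) (v ++ suc k ∷ z ∷ s) refl (proj₁ z-label) (≤∧≢⇒< (proj₂ z-label) z≢m)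
  z-m-m-z = ++⁺ (from∈ z∈u) (refl ∷ ++⁺ˡ v (refl ∷ refl ∷ minimum s))

IsBL-remove-max : ∀ {k} u v → IsBL (suc k) (u ++ suc k ∷ v ++ [ suc k ]) → suc k ∉ u → suc k ∉ v → IsBL k (u ++ v)
IsBL-remove-max u v bl m∉u m∉v = subst (IsBL _) (erase-twice _ u v m∉u m∉v) (IsBL-erase-max bl)

occurs-before-first-max : ∀ {k} u v post → IsBL (suc k) (u ++ suc k ∷ v ++ post) → suc k ∉ v →
  All (λ x → x < suc k × x ∈ u) v
occurs-before-first-max u v post bl m∉v = All.tabulate λ {x} x∈v →
  let 1≤x , x≤m = IsBL-label bl (∈-++⁺ʳ u (there (∈-++⁺ˡ x∈v)))
      x<m = ≤∧≢⇒< x≤m (λ x≡m → m∉v (subst (_∈ v) x≡m x∈v))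
  in x<m , smaller-label-precedes bl u _ (v ++ post) refl 1≤x x<m

bottomWord↝*-step : ∀ k u v → IsBL (suc k) (u ++ suc k ∷ v ++ [ suc k ]) → suc k ∉ v →
  bottomWord k ↝* (u ++ v) → bottomWord (suc k) ↝* (u ++ suc k ∷ v ++ [ suc k ])
bottomWord↝*-step k u v bl m∉v ih =
  subst (_↝* (u ++ m ∷ v ++ [ m ])) (sym (bottomWord-suc k))
    (subst (_ ↝*_) (++-assoc u v (m ∷ m ∷ [])) (↝*-++ʳ (m ∷ m ∷ []) ih)
     ◅◅ ↝*-moveLeft u v m [ m ] (occurs-before-first-max u v [ m ] bl m∉v))
  where m = suc k

insertAfterFirst-topWord : ∀ j → let L = suc j; m = suc L in
  insertAfterFirst L m (topWord L) ++ [ m ] ≡ topWord m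
insertAfterFirst-topWord j = begin
  insertAfterFirst L m (ups L ++ ups L) ++ [ m ]
    ≡⟨ cong (λ z → insertAfterFirst L m (z ++ ups L) ++ [ m ]) (ups-suc j) ⟩
  insertAfterFirst L m ((ups j ++ [ L ]) ++ ups L) ++ [ m ]
    ≡⟨ cong (λ z → insertAfterFirst L m z ++ [ m ]) (++-assoc (ups j) [ L ] (ups L)) ⟩
  insertAfterFirst L m (ups j ++ L ∷ ups L) ++ [ m ]
    ≡⟨ cong (_++ [ m ]) (insertAfterFirst-first (ups j) (ups L) (λ L∈ → 1+n≰n (∈-ups⇒≤ j L∈))) ⟩
  (ups j ++ L ∷ m ∷ ups L) ++ [ m ]
    ≡⟨ solve 4 (λ a l n b → (a ⊕ l ⊕ n ⊕ b) ⊕ n ⊜ ((a ⊕ l) ⊕ n) ⊕ (b ⊕ n)) refl (ups j) [ L ] [ m ] (ups L) ⟩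
  ((ups j ++ [ L ]) ++ [ m ]) ++ (ups L ++ [ m ])
    ≡⟨ cong₂ (λ a b → (a ++ [ m ]) ++ b) (ups-suc j) (ups-suc L) ⟨
  (ups L ++ [ m ]) ++ ups m
    ≡⟨ cong (_++ ups m) (ups-suc L) ⟨
  ups m ++ ups m ∎
  where
  open ≡-Reasoning
  L = suc j
  m = suc L

↝*topWord-step : ∀ k u v → IsBL (suc k) (u ++ suc k ∷ v ++ [ suc k ]) → suc k ∉ u → suc k ∉ v →
  (u ++ v) ↝* topWord k → (u ++ suc k ∷ v ++ [ suc k ]) ↝* topWord (suc k)
↝*topWord-step zero [] [] _ _ _ _ = ε
↝*topWord-step zero [] (x ∷ _) bl _ 1∉v _ with 1≤x , x≤1 ← IsBL-label bl (there (here refl)) =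
  ⊥-elim (1∉v (here (≤-antisym 1≤x x≤1)))
↝*topWord-step zero (x ∷ _) _ bl 1∉u _ _ with 1≤x , x≤1 ← IsBL-label bl (here refl) =
  ⊥-elim (1∉u (here (≤-antisym 1≤x x≤1)))
↝*topWord-step (suc j) u v bl m∉u m∉v ih
  with u₁ , u₂ , refl , L∉u₁ ←
         first-occurrence u (smaller-label-precedes bl u (suc (suc j)) (v ++ [ suc (suc j) ]) refl (s≤s z≤n) ≤-refl) =
  slide-m ◅◅ lift-ih
  where
  L = suc j
  m = suc L
  lifted-source : insertAfterFirst L m ((u₁ ++ L ∷ u₂) ++ v) ++ [ m ] ≡ (u₁ ++ [ L ]) ++ m ∷ u₂ ++ v ++ [ m ]
  lifted-source = begin
    insertAfterFirst L m ((u₁ ++ L ∷ u₂) ++ v) ++ [ m ]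
      ≡⟨ cong (λ z → insertAfterFirst L m z ++ [ m ]) (++-assoc u₁ (L ∷ u₂) v) ⟩
    insertAfterFirst L m (u₁ ++ L ∷ u₂ ++ v) ++ [ m ]
      ≡⟨ cong (_++ [ m ]) (insertAfterFirst-first u₁ (u₂ ++ v) L∉u₁) ⟩
    (u₁ ++ L ∷ m ∷ u₂ ++ v) ++ [ m ]
      ≡⟨ solve 6 (λ a l n b c d → (a ⊕ l ⊕ n ⊕ b ⊕ c) ⊕ d ⊜ (a ⊕ l) ⊕ n ⊕ b ⊕ c ⊕ d)
                 refl u₁ [ L ] [ m ] u₂ v [ m ] ⟩
    (u₁ ++ [ L ]) ++ m ∷ u₂ ++ v ++ [ m ] ∎
    where open ≡-Reasoning
  u₂-earlier : All (λ x → x < m × x ∈ u₁ ++ [ L ]) u₂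
  u₂-earlier = All.tabulate λ {x} x∈u₂ →
    let x∈u = ∈-++⁺ʳ u₁ (there x∈u₂)
        1≤x , x≤m = IsBL-label bl (∈-++⁺ˡ x∈u)
        x<m = ≤∧≢⇒< x≤m (λ x≡m → m∉u (subst (_∈ u₁ ++ L ∷ u₂) x≡m x∈u))
    in x<m , label-precedes-or-is bl u₁ L (u₂ ++ m ∷ v ++ [ m ]) (++-assoc u₁ (L ∷ u₂) _) 1≤x (≤-pred x<m)
  slide-m : (u₁ ++ L ∷ u₂) ++ m ∷ v ++ [ m ] ↝* (u₁ ++ [ L ]) ++ m ∷ u₂ ++ v ++ [ m ]
  slide-m = subst (_↝* ((u₁ ++ [ L ]) ++ m ∷ u₂ ++ v ++ [ m ]))
    (solve 5 (λ a l b n c → (a ⊕ l) ⊕ b ⊕ n ⊕ c ⊜ (a ⊕ l ⊕ b) ⊕ n ⊕ c) refl u₁ [ L ] u₂ [ m ] (v ++ [ m ]))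
    (↝*-moveLeft (u₁ ++ [ L ]) u₂ m (v ++ [ m ]) u₂-earlier)
  lift-ih : (u₁ ++ [ L ]) ++ m ∷ u₂ ++ v ++ [ m ] ↝* topWord m
  lift-ih = subst₂ _↝*_ lifted-source (insertAfterFirst-topWord j)
    (↝*-++ʳ [ m ] (↝*-insertAfterFirst ≤-refl (All.map proj₂ (IsBL.labels (IsBL-remove-max _ v bl m∉u m∉v))) ih))

Avoids1221⇒between : ∀ n w → IsBL n w → Avoids1221 w → bottomWord n ↝* w × w ↝* topWord n
Avoids1221⇒between zero [] _ _ = ε , ε
Avoids1221⇒between zero (x ∷ _) bl _ with 1≤x , x≤0 ← IsBL-label bl (here refl) = ⊥-elim (1+n≰n (≤-trans 1≤x x≤0))
Avoids1221⇒between (suc k) w bl av with u , v , refl , m∉u , m∉v ← Avoids1221-max-split bl av =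
  bottomWord↝*-step k u v bl m∉v (proj₁ ih) , ↝*topWord-step k u v bl m∉u m∉v (proj₂ ih)
  where
  m = suc k
  uv⊆w : u ++ v ⊆ u ++ m ∷ v ++ [ m ]
  uv⊆w = ++⁺ ⊆-refl (m ∷ʳ ++⁺ʳ [ m ] ⊆-refl)
  ih = Avoids1221⇒between k (u ++ v) (IsBL-remove-max u v bl m∉u m∉v)
         (λ (x , y , x≢y , sub) → av (x , y , x≢y , ⊆-trans sub uv⊆w))

proposition6p3 : (n : ℕ) → 1 ≤ n → (w : Word) → IsBL n w →
    Avoids1221 w ⇔ (bottomWord n ≤BL[ n ] w × w ≤BL[ n ] topWord n)
proposition6p3 n _ w bl = mk⇔ between avoids
  where
  between : Avoids1221 w → bottomWord n ≤BL[ n ] w × w ≤BL[ n ] topWord n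
  between av = let bottom↝*w , w↝*top = Avoids1221⇒between n w bl av
               in ↝*⇒≤BLʳ bl bottom↝*w , ↝*⇒≤BLˡ bl w↝*top
  avoids : bottomWord n ≤BL[ n ] w × w ≤BL[ n ] topWord n → Avoids1221 w
  avoids (_ , w≤top) = topWord-avoids n ∘ ≤BL-Contains1221 w≤top
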